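{- Let $\psi:\mathbb{N}\to\mathbb{N}$ be an injective function and let $A=\psi(\mathbb{N})$. For every $n\in\mathbb{N}$, \[ p^{A}(n)=\sum_{(N_0,N_1,N_2,\dots)}\ \prod_{j\ge 0} p^{A}_{1}(N_j), \] where the sum runs over all sequences $(N_0,N_1,N_2,\dots)$ of non-negative integers (all but finitely many equal to $0$) satisfying $n=\sum_{i\ge 0}2^{i}N_i$.
   Context: Here $\mathbb{N}=\{0,1,2,\dots\}$. A partition of $n$ into elements of $A$ is a multiset of positive integers belonging to $A$ whose sum is $n$. $p^{A}(n)$ is the number of partitions of $n$ into elements of $A$ (no restriction on repetitions), and for $\alpha\ge 1$, $p^{A}_{\alpha}(n)$ is the number of partitions of $n$ into elements of $A$ in which each part occurs at most $\alpha$ times (so $p^A_1$ counts partitions into distinct elements of $A$). By convention $p^{A}(0)=p^{A}_{\alpha}(0)=1$. (In the paper the solutions $(N_0,N_1,\dots)$ are listed as the rows $(a^n_{i1},a^n_{i2},\dots)$ of a "solution matrix" $A_n$.) -}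

module Defs where

open import Data.Nat using (ℕ; zero; suc; _+_; _*_; _^_; _≤_; _<_; _≥_; _>_; _≟_)
open import Data.List using (List; []; _∷_; map; filter; concatMap; upTo)
open import Data.Nat.ListAction using (sum; product)
open import Data.List.Relation.Unary.All using (All)
open import Data.List.Relation.Unary.Linked using (Linked)
open import Data.Vec using (Vec; []; _∷_; toList)
open import Data.Product using (Σ; _×_)
open import Relation.Binary.PropositionalEquality using (_≡_)

InImage : (ℕ → ℕ) → ℕ → Set
InImage ψ a = Σ ℕ (λ k → ψ k ≡ a)

-- A partition of n into elements of A = ψ(ℕ): a multiset of positive
-- integers in A summing to n, represented canonically as a
-- non-increasing list of parts.
record Partition (ψ : ℕ → ℕ) (n : ℕ) : Set where
  constructor mkPartition
  field
    parts    : List ℕ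
    positive : All (λ a → 0 < a) parts
    inA      : All (InImage ψ) parts
    sorted   : Linked _≥_ parts
    total    : sum parts ≡ n

-- A partition of n into DISTINCT elements of A (each part at most once):
-- represented as a strictly decreasing list of parts.
record DistinctPartition (ψ : ℕ → ℕ) (n : ℕ) : Set where
  constructor mkDistinctPartition
  field
    parts    : List ℕ
    positive : All (λ a → 0 < a) parts
    inA      : All (InImage ψ) parts
    sorted   : Linked _>_ parts
    total    : sum parts ≡ n

allVecs : ℕ → (k : ℕ) → List (Vec ℕ k)
allVecs m zero    = [] ∷ []
allVecs m (suc k) = concatMap (λ x → map (x ∷_) (allVecs m k)) (upTo m)

weightedFrom : ℕ → {k : ℕ} → Vec ℕ k → ℕ
weightedFrom i []       = 0
weightedFrom i (x ∷ xs) = 2 ^ i * x + weightedFrom (suc i) xs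

weighted : {k : ℕ} → Vec ℕ k → ℕ
weighted = weightedFrom 0

-- Right-hand side:  Σ_{(N_0,N_1,…) : Σ 2^i N_i = n}  Π_j p₁(N_j).
-- Any such sequence has N_i ≤ n for all i and N_i = 0 for i > n
-- (since 2^i > n), so the sequences are exactly the vectors
-- (N_0,…,N_n) with entries ≤ n and weighted sum n, extended by zeros;
-- the factors for j > n are p₁(0) = 1.
rhs : (ℕ → ℕ) → ℕ → ℕ
rhs p₁ n = sum (map (λ v → product (map p₁ (toList v)))
                    (filter (λ v → weighted v ≟ n) (allVecs (suc n) (suc n))))

-- A partition of n into parts from A is a vector of multiplicities (m_a)_{a ∈ A} with
-- Σ_a a·m_a = n.  Writing every multiplicity in binary, m_a = Σ_i 2^i ε_{a,i} with
-- ε_{a,i} ∈ {0,1}, cuts it into partitions D_i = {a | ε_{a,i} = 1} into distinct parts of A,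
-- and n = Σ_i 2^i N_i where N_i is the sum of D_i.  Conversely every such sequence (D_i)
-- assembles to a partition of n, so partitions of n correspond to sequences (N_i) with
-- Σ_i 2^i N_i = n together with a distinct partition of each N_i; counting gives the
-- formula.  Binary digits are obtained by repeated halving, μ ↦ (μ mod 2, μ div 2), and
-- since 2^(n+1) > n only the digits i ≤ n can be non-zero.

module Submission where

open import Defs
open import Data.Bool using (true; false; if_then_else_)
open import Data.Empty using (⊥-elim)
open import Data.Fin using (Fin)
open import Data.Fin.Permutation using (↔⇒≡)
open import Data.Fin.Properties using (+↔⊎; *↔×; 1↔⊤)
open import Data.List using (List; []; _∷_; _++_; replicate; map; filter; concatMap; applyUpTo; upTo)
open import Data.List.Properties using (map-++; map-∘; map-cong)
import Data.List.Relation.Unary.All as ListAll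
open ListAll using ([]; _∷_)
open import Data.List.Relation.Unary.All.Properties using (++⁺; replicate⁺)
import Data.List.Relation.Unary.AllPairs as AllPairs
open import Data.List.Relation.Unary.Linked as Linked using (Linked; []; [-]; _∷_)
open import Data.List.Relation.Unary.Linked.Properties using (Linked⇒All; Linked⇒AllPairs)
open import Data.Nat using (ℕ; zero; suc; _+_; _*_; _^_; _≤_; _<_; _≥_; _>_; z≤n; s≤s; z<s; _≟_)
open import Data.Nat.DivMod
  using (_%_; _/_; m≡m%n+[m/n]*n; m%n<n; [m+kn]%n≡m%n; m<n⇒m%n≡m; m<n⇒m/n≡0; +-distrib-/-∣ʳ; m*n/n≡m)
open import Data.Nat.Divisibility using (divides-refl)
open import Data.Nat.ListAction using (sum; product)
open import Data.Nat.ListAction.Properties using (sum-++)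
open import Data.Nat.Properties
open import Data.Nat.Solver using (module +-*-Solver)
open import Data.Product using (Σ; _×_; _,_; proj₁; proj₂)
open import Data.Product.Function.Dependent.Propositional using (Σ-↔)
open import Data.Product.Function.NonDependent.Propositional using (_×-↔_)
open import Data.Sum using (_⊎_; inj₁; inj₂)
open import Data.Sum.Function.Propositional using (_⊎-↔_)
open import Data.Unit using (⊤; tt)
open import Data.Vec using (Vec; []; _∷_; toList; zipWith)
import Data.Vec as Vec
open import Data.Vec.Relation.Unary.All as VecAll using (All; []; _∷_)
open import Function.Base using (_∘_; id)
open import Function.Bundles using (_↔_; Inverse; mk↔ₛ′)
open import Function.Definitions using (Injective)
open import Function.Properties.Inverse using (↔-refl; ↔-sym; ↔-trans)
open import Function.Related.Propositional using (K-reflexive)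
import Function.Related.Propositional as Related
open import Function.Related.TypeIsomorphisms using (Σ-assoc)
open import Relation.Binary.PropositionalEquality
import Relation.Binary.Construct.Flip.EqAndOrd as Flip
open import Relation.Nullary using (Dec; yes; no; does; Irrelevant)

private variable
  A B : Set
  b k m n : ℕ

×-irrelevant : Irrelevant A → Irrelevant B → Irrelevant (A × B)
×-irrelevant irrA irrB (x , y) (x′ , y′) = cong₂ _,_ (irrA x x′) (irrB y y′)

Σ-≡-irrelevant : {P : A → Set} → (∀ a → Irrelevant (P a)) →
                 {a a′ : A} {p : P a} {p′ : P a′} → a ≡ a′ → (a , p) ≡ (a′ , p′)
Σ-≡-irrelevant irr {a} {p = p} {p′} refl = cong (a ,_) (irr a p p′)

↔-×-implied : Irrelevant B → (A → B) → A ↔ (B × A)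
↔-×-implied irr f =
  mk↔ₛ′ (λ a → f a , a) proj₂ (λ { (b , a) → cong (_, a) (irr (f a) b) }) (λ _ → refl)

Σ-↔-weighted : {W : Set} {P : W → Set} {wA : A → W} {wB : B → W} (f : A ↔ B) →
               (∀ a → wB (Inverse.to f a) ≡ wA a) → Σ A (P ∘ wA) ↔ Σ B (P ∘ wB)
Σ-↔-weighted {P = P} f pres = Σ-↔ f (λ {a} → K-reflexive (cong P (sym (pres a))))

Fibre : (A → B) → B → Set
Fibre {A} w y = Σ A (λ a → w a ≡ y)

All-∷↔ : {P : A → Set} {x : A} {v : Vec A k} → All P (x ∷ v) ↔ (P x × All P v)
All-∷↔ = mk↔ₛ′ (λ { (p ∷ ps) → p , ps }) (λ { (p , ps) → p ∷ ps }) (λ _ → refl) (λ { (_ ∷ _) → refl })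

All-↔ : {P Q : A → Set} {v : Vec A k} → All (λ x → P x ↔ Q x) v → All P v ↔ All Q v
All-↔ [] = mk↔ₛ′ (λ { [] → [] }) (λ { [] → [] }) (λ { [] → refl }) (λ { [] → refl })
All-↔ (P↔Q ∷ Ps↔Qs) = ↔-trans All-∷↔ (↔-trans (P↔Q ×-↔ All-↔ Ps↔Qs) (↔-sym All-∷↔))

Vec-∷↔ : (A × (Vec A k × B)) ↔ (Vec A (suc k) × B)
Vec-∷↔ = mk↔ₛ′ (λ { (a , as , b) → a ∷ as , b }) (λ { (a ∷ as , b) → a , as , b })
               (λ { (_ ∷ _ , _) → refl }) (λ { (_ , _ , _) → refl })

Vec↔weights×fibres : (w : A → B) → Vec A k ↔ Σ (Vec B k) (All (Fibre w))
Vec↔weights×fibres w = mk↔ₛ′ (λ as → Vec.map w as , fibres as) (points ∘ proj₂)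
                             (λ { (v , fs) → to∘from v fs }) from∘to
  where
  fibres : (as : Vec _ k) → All (Fibre w) (Vec.map w as)
  fibres []       = []
  fibres (a ∷ as) = (a , refl) ∷ fibres as
  points : {v : Vec _ k} → All (Fibre w) v → Vec _ k
  points []             = []
  points ((a , _) ∷ fs) = a ∷ points fs
  from∘to : (as : Vec _ k) → points (fibres as) ≡ as
  from∘to []       = refl
  from∘to (a ∷ as) = cong (a ∷_) (from∘to as)
  to∘from : (v : Vec _ k) (fs : All (Fibre w) v) →
            _≡_ {A = Σ (Vec _ k) (All (Fibre w))} (Vec.map w (points fs) , fibres (points fs)) (v , fs)
  to∘from []      []                = refl
  to∘from (_ ∷ v) ((a , refl) ∷ fs) =
    cong (λ { (v′ , fs′) → w a ∷ v′ , (a , refl) ∷ fs′ }) (to∘from v fs)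

Σ-Vec↔weights×fibres : (w : A → B) (P : Vec B k → Set) →
                       Σ (Vec A k) (λ as → P (Vec.map w as)) ↔ Σ (Vec B k) (λ v → All (Fibre w) v × P v)
Σ-Vec↔weights×fibres w P = ↔-trans (Σ-↔-weighted {P = P} (Vec↔weights×fibres w) (λ _ → refl)) Σ-assoc

Σ<suc↔⊎ : {P : ℕ → Set} → Σ ℕ (λ x → x < suc b × P x) ↔ (P 0 ⊎ Σ ℕ (λ x → x < b × P (suc x)))
Σ<suc↔⊎ {b} {P} = mk↔ₛ′ split join split∘join join∘split
  where
  split : Σ ℕ (λ x → x < suc b × P x) → P 0 ⊎ Σ ℕ (λ x → x < b × P (suc x))
  split (zero  , _         , p) = inj₁ p
  split (suc x , s≤s x<b , p) = inj₂ (x , x<b , p)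
  join : P 0 ⊎ Σ ℕ (λ x → x < b × P (suc x)) → Σ ℕ (λ x → x < suc b × P x)
  join (inj₁ p)             = zero , s≤s z≤n , p
  join (inj₂ (x , x<b , p)) = suc x , s≤s x<b , p
  split∘join : ∀ y → split (join y) ≡ y
  split∘join (inj₁ _) = refl
  split∘join (inj₂ _) = refl
  join∘split : ∀ y → join (split y) ≡ y
  join∘split (zero  , s≤s z≤n , _) = refl
  join∘split (suc _ , s≤s _   , _) = refl

Σ<-count : {P : ℕ → Set} (g : ℕ → ℕ) → (∀ y → P y ↔ Fin (g y)) →
           ∀ (f : ℕ → ℕ) b → Σ ℕ (λ x → x < b × P (f x)) ↔ Fin (sum (map g (applyUpTo f b)))
Σ<-count g P↔ f zero    = mk↔ₛ′ (λ { (_ , () , _) }) (λ ()) (λ ()) (λ { (_ , () , _) })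
Σ<-count g P↔ f (suc b) =
  ↔-trans Σ<suc↔⊎ (↔-trans (P↔ (f 0) ⊎-↔ Σ<-count g P↔ (f ∘ suc) b) (↔-sym +↔⊎))

sum-map-concatMap : (f : B → ℕ) (h : A → List B) (xs : List A) →
                    sum (map f (concatMap h xs)) ≡ sum (map (sum ∘ map f ∘ h) xs)
sum-map-concatMap f h []       = refl
sum-map-concatMap f h (x ∷ xs) = begin
  sum (map f (h x ++ concatMap h xs))               ≡⟨ cong sum (map-++ f (h x) _) ⟩
  sum (map f (h x) ++ map f (concatMap h xs))       ≡⟨ sum-++ (map f (h x)) _ ⟩
  sum (map f (h x)) + sum (map f (concatMap h xs))  ≡⟨ cong (sum (map f (h x)) +_) (sum-map-concatMap f h xs) ⟩
  sum (map f (h x)) + sum (map (sum ∘ map f ∘ h) xs) ∎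
  where open ≡-Reasoning

allVecs-count : {T : Vec ℕ k → Set} (f : Vec ℕ k → ℕ) → (∀ v → T v ↔ Fin (f v)) →
                Σ (Vec ℕ k) (λ v → All (_< b) v × T v) ↔ Fin (sum (map f (allVecs b k)))
allVecs-count {zero} {b} {T} f T↔ = begin
  Σ (Vec ℕ 0) (λ v → All (_< b) v × T v)
    ↔⟨ mk↔ₛ′ (λ { ([] , [] , t) → t }) (λ t → [] , [] , t) (λ _ → refl) (λ { ([] , [] , _) → refl }) ⟩
  T []
    ↔⟨ T↔ [] ⟩
  Fin (f [])
    ≡⟨ cong Fin (sym (+-identityʳ (f []))) ⟩
  Fin (f [] + 0) ∎
  where open Related.EquationalReasoning
allVecs-count {suc k} {b} {T} f T↔ = begin
  Σ (Vec ℕ (suc k)) (λ v → All (_< b) v × T v)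
    ↔⟨ uncons ⟩
  Σ ℕ (λ x → x < b × Σ (Vec ℕ k) (λ w → All (_< b) w × T (x ∷ w)))
    ↔⟨ Σ<-count _ (λ x → allVecs-count (f ∘ (x ∷_)) (T↔ ∘ (x ∷_))) id b ⟩
  Fin (sum (map (λ x → sum (map (f ∘ (x ∷_)) (allVecs b k))) (upTo b)))
    ≡⟨ cong Fin (sym sum-allVecs) ⟩
  Fin (sum (map f (allVecs b (suc k)))) ∎
  where
  open Related.EquationalReasoning
  uncons : Σ (Vec ℕ (suc k)) (λ v → All (_< b) v × T v) ↔
           Σ ℕ (λ x → x < b × Σ (Vec ℕ k) (λ w → All (_< b) w × T (x ∷ w)))
  uncons = mk↔ₛ′ (λ { (x ∷ w , x<b ∷ w<b , t) → x , x<b , w , w<b , t })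
                 (λ { (x , x<b , w , w<b , t) → x ∷ w , x<b ∷ w<b , t })
                 (λ _ → refl) (λ { (_ ∷ _ , _ ∷ _ , _) → refl })
  sum-allVecs : sum (map f (allVecs b (suc k))) ≡
                sum (map (λ x → sum (map (f ∘ (x ∷_)) (allVecs b k))) (upTo b))
  sum-allVecs = trans (sum-map-concatMap f (λ x → map (x ∷_) (allVecs b k)) (upTo b))
                      (cong sum (map-cong (λ x → cong sum (sym (map-∘ (allVecs b k)))) (upTo b)))

sum-map-filter : {P : A → Set} (P? : ∀ x → Dec (P x)) (g : A → ℕ) (xs : List A) →
                 sum (map g (filter P? xs)) ≡ sum (map (λ x → if does (P? x) then g x else 0) xs)
sum-map-filter P? g []       = refl
sum-map-filter P? g (x ∷ xs) with does (P? x)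
... | true  = cong (g x +_) (sum-map-filter P? g xs)
... | false = sum-map-filter P? g xs

×-Dec-count : (P? : Dec B) → Irrelevant B → A ↔ Fin k → (A × B) ↔ Fin (if does P? then k else 0)
×-Dec-count (yes p) irr A↔ =
  ↔-trans (mk↔ₛ′ proj₁ (_, p) (λ _ → refl) (λ { (a , p′) → cong (a ,_) (irr p p′) })) A↔
×-Dec-count (no ¬p) _ _ =
  mk↔ₛ′ (λ { (_ , p) → ⊥-elim (¬p p) }) (λ ()) (λ ()) (λ { (_ , p) → ⊥-elim (¬p p) })

All-count : {F : ℕ → Set} (q : ℕ → ℕ) → (∀ x → F x ↔ Fin (q x)) →
            (v : Vec ℕ k) → All F v ↔ Fin (product (map q (toList v)))
All-count q F↔ []      =
  ↔-trans (mk↔ₛ′ (λ _ → tt) (λ _ → []) (λ _ → refl) (λ { [] → refl })) (↔-sym 1↔⊤)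
All-count q F↔ (x ∷ v) = ↔-trans All-∷↔ (↔-trans (F↔ x ×-↔ All-count q F↔ v) (↔-sym *↔×))

rhs-count : {F : ℕ → Set} (p₁ : ℕ → ℕ) → (∀ m → F m ↔ Fin (p₁ m)) → ∀ n →
            Σ (Vec ℕ (suc n)) (λ v → All (_< suc n) v × (All F v × weighted v ≡ n)) ↔ Fin (rhs p₁ n)
rhs-count p₁ F↔ n =
  ↔-trans (allVecs-count _ (λ v → ×-Dec-count (weighted v ≟ n) ≡-irrelevant (All-count p₁ F↔ v)))
          (K-reflexive (cong Fin (sym (sum-map-filter (λ v → weighted v ≟ n) _ (allVecs (suc n) (suc n))))))

weightedFrom-suc : ∀ i (v : Vec ℕ k) → weightedFrom (suc i) v ≡ 2 * weightedFrom i v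
weightedFrom-suc i []      = refl
weightedFrom-suc i (x ∷ v) = begin
  2 ^ suc i * x + weightedFrom (suc (suc i)) v   ≡⟨ cong₂ _+_ (*-assoc 2 (2 ^ i) x) (weightedFrom-suc (suc i) v) ⟩
  2 * (2 ^ i * x) + 2 * weightedFrom (suc i) v   ≡⟨ *-distribˡ-+ 2 (2 ^ i * x) _ ⟨
  2 * (2 ^ i * x + weightedFrom (suc i) v)       ∎
  where open ≡-Reasoning

weighted-∷ : ∀ x (v : Vec ℕ k) → weighted (x ∷ v) ≡ x + 2 * weighted v
weighted-∷ x v = cong₂ _+_ (*-identityˡ x) (weightedFrom-suc 0 v)

weightedFrom≤⇒All< : ∀ i (v : Vec ℕ k) → weightedFrom i v ≤ n → All (_< suc n) v
weightedFrom≤⇒All< i []      _  = []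
weightedFrom≤⇒All< i (x ∷ v) ≤n =
  s≤s (≤-trans (m≤n*m x (2 ^ i) {{m^n≢0 2 i}}) (≤-trans (m≤m+n _ _) ≤n))
  ∷ weightedFrom≤⇒All< (suc i) v (≤-trans (m≤n+m _ _) ≤n)

n<2^n : ∀ n → n < 2 ^ n
n<2^n zero    = s≤s z≤n
n<2^n (suc n) = ≤-trans (+-mono-≤ (m^n>0 2 n) (n<2^n n))
                        (≤-reflexive (cong (2 ^ n +_) (sym (+-identityʳ (2 ^ n)))))

Σ-×-discard-high-part : {X M : Set} (f : X → ℕ) (g : M → ℕ) {c : ℕ} (z : M) →
                        g z ≡ 0 → (∀ μ → g μ ≡ 0 → μ ≡ z) → n < c →
                        Σ (X × M) (λ xμ → f (proj₁ xμ) + c * g (proj₂ xμ) ≡ n) ↔ Σ X (λ x → f x ≡ n)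
Σ-×-discard-high-part {n} f g {c} z gz≡0 unique n<c =
  mk↔ₛ′ to from (λ _ → Σ-≡-irrelevant (λ _ → ≡-irrelevant) refl) from∘to
  where
  coefficient≡0 : ∀ a q → a + c * q ≡ n → q ≡ 0
  coefficient≡0 a zero    _ = refl
  coefficient≡0 a (suc q) e =
    ⊥-elim (<-irrefl refl (<-≤-trans n<c (≤-trans (m≤m*n c (suc q)) (≤-trans (m≤n+m _ a) (≤-reflexive e)))))
  drop-term : ∀ a q → q ≡ 0 → a + c * q ≡ a
  drop-term a _ refl = trans (cong (a +_) (*-zeroʳ c)) (+-identityʳ a)
  to : Σ (_ × _) (λ xμ → f (proj₁ xμ) + c * g (proj₂ xμ) ≡ n) → Σ _ (λ x → f x ≡ n)
  to ((x , μ) , e) = x , trans (sym (drop-term (f x) (g μ) (coefficient≡0 (f x) (g μ) e))) e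
  from : Σ _ (λ x → f x ≡ n) → Σ (_ × _) (λ xμ → f (proj₁ xμ) + c * g (proj₂ xμ) ≡ n)
  from (x , e) = (x , z) , trans (drop-term (f x) (g z) gz≡0) e
  from∘to : ∀ y → from (to y) ≡ y
  from∘to ((x , μ) , e) =
    Σ-≡-irrelevant (λ _ → ≡-irrelevant) (cong (x ,_) (sym (unique μ (coefficient≡0 (f x) (g μ) e))))

-- A vector (m_b, …, m_1): m_c is the multiplicity of the part c.
expand : Vec ℕ b → List ℕ
expand []                = []
expand {suc b} (k ∷ ms) = replicate k (suc b) ++ expand ms

weight : Vec ℕ b → ℕ
weight []                = 0
weight {suc b} (k ∷ ms) = k * suc b + weight ms

runLength : ℕ → List ℕ → ℕ
runLength c []       = 0
runLength c (x ∷ xs) with x ≟ c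
... | yes _ = suc (runLength c xs)
... | no  _ = 0

dropRun : ℕ → List ℕ → List ℕ
dropRun c []       = []
dropRun c (x ∷ xs) with x ≟ c
... | yes _ = dropRun c xs
... | no  _ = x ∷ xs

multiplicities : ∀ b → List ℕ → Vec ℕ b
multiplicities zero    xs = []
multiplicities (suc b) xs = runLength (suc b) xs ∷ multiplicities b (dropRun (suc b) xs)

runLength-replicate : ∀ c k {ys} → ListAll.All (_< c) ys → runLength c (replicate k c ++ ys) ≡ k
runLength-replicate c zero    []            = refl
runLength-replicate c zero {y ∷ _} (y<c ∷ _) with y ≟ c
... | yes refl = ⊥-elim (<-irrefl refl y<c)
... | no  _    = refl
runLength-replicate c (suc k) ys<c with c ≟ c
... | yes _   = cong suc (runLength-replicate c k ys<c)
... | no  c≢c = ⊥-elim (c≢c refl)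

dropRun-replicate : ∀ c k {ys} → ListAll.All (_< c) ys → dropRun c (replicate k c ++ ys) ≡ ys
dropRun-replicate c zero    []        = refl
dropRun-replicate c zero {y ∷ _} (y<c ∷ _) with y ≟ c
... | yes refl = ⊥-elim (<-irrefl refl y<c)
... | no  _    = refl
dropRun-replicate c (suc k) ys<c with c ≟ c
... | yes _   = dropRun-replicate c k ys<c
... | no  c≢c = ⊥-elim (c≢c refl)

replicate-runLength-dropRun : ∀ c xs → replicate (runLength c xs) c ++ dropRun c xs ≡ xs
replicate-runLength-dropRun c []       = refl
replicate-runLength-dropRun c (x ∷ xs) with x ≟ c
... | yes refl = cong (x ∷_) (replicate-runLength-dropRun c xs)
... | no  _    = refl

dropRun-All : ∀ {P : ℕ → Set} c {xs} → ListAll.All P xs → ListAll.All P (dropRun c xs)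
dropRun-All c []                   = []
dropRun-All c {x ∷ _} (px ∷ pxs) with x ≟ c
... | yes _ = dropRun-All c pxs
... | no  _ = px ∷ pxs

dropRun-Linked : ∀ {R : ℕ → ℕ → Set} c {xs} → Linked R xs → Linked R (dropRun c xs)
dropRun-Linked c {[]}     l = l
dropRun-Linked c {x ∷ _} l with x ≟ c
... | yes _ = dropRun-Linked c (Linked.tail l)
... | no  _ = l

dropRun-≤ : ∀ {xs} → Linked _≥_ xs → ListAll.All (_≤ suc b) xs → ListAll.All (_≤ b) (dropRun (suc b) xs)
dropRun-≤ {b} {[]}     _      _                = []
dropRun-≤ {b} {x ∷ _} sorted (x≤1+b ∷ xs≤1+b) with x ≟ suc b
... | yes _    = dropRun-≤ (Linked.tail sorted) xs≤1+b
... | no x≢1+b = Linked⇒All (Flip.trans _≤_ ≤-trans) (≤-pred (≤∧≢⇒< x≤1+b x≢1+b)) sorted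

runLength-≤1 : ∀ c {xs} → Linked _>_ xs → runLength c xs ≤ 1
runLength-≤1 c {[]}     _      = z≤n
runLength-≤1 c {x ∷ _} strict with x ≟ c
... | yes refl = s≤s (≤-reflexive (runLength-replicate x 0 xs<x))
  where xs<x = AllPairs.head (Linked⇒AllPairs (Flip.trans _<_ <-trans) strict)
... | no  _    = z≤n

∷-Linked : ∀ {R : ℕ → ℕ → Set} {x xs} → ListAll.All (R x) xs → Linked R xs → Linked R (x ∷ xs)
∷-Linked []      _ = [-]
∷-Linked (r ∷ _) l = r ∷ l

expand-≤ : (ms : Vec ℕ b) → ListAll.All (_≤ b) (expand ms)
expand-≤ []       = []
expand-≤ (k ∷ ms) = ++⁺ (replicate⁺ k ≤-refl) (ListAll.map m≤n⇒m≤1+n (expand-≤ ms))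

expand-positive : (ms : Vec ℕ b) → ListAll.All (0 <_) (expand ms)
expand-positive []       = []
expand-positive (k ∷ ms) = ++⁺ (replicate⁺ k z<s) (expand-positive ms)

expand-sorted : (ms : Vec ℕ b) → Linked _≥_ (expand ms)
expand-sorted []                = []
expand-sorted {suc b} (k ∷ ms) = replicate-sorted k
  where
  replicate-sorted : ∀ k → Linked _≥_ (replicate k (suc b) ++ expand ms)
  replicate-sorted zero    = expand-sorted ms
  replicate-sorted (suc k) =
    ∷-Linked (++⁺ (replicate⁺ k ≤-refl) (ListAll.map m≤n⇒m≤1+n (expand-≤ ms))) (replicate-sorted k)

expand-strict : (ms : Vec ℕ b) → All (_≤ 1) ms → Linked _>_ (expand ms)
expand-strict []                 []            = []
expand-strict (zero ∷ ms)        (_ ∷ ms≤1)    = expand-strict ms ms≤1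
expand-strict (suc zero ∷ ms)    (_ ∷ ms≤1)    =
  ∷-Linked (ListAll.map s≤s (expand-≤ ms)) (expand-strict ms ms≤1)
expand-strict (suc (suc _) ∷ _) (s≤s () ∷ _)

sum-replicate : ∀ k c → sum (replicate k c) ≡ k * c
sum-replicate zero    c = refl
sum-replicate (suc k) c = cong (c +_) (sum-replicate k c)

sum-expand : (ms : Vec ℕ b) → sum (expand ms) ≡ weight ms
sum-expand []                = refl
sum-expand {suc b} (k ∷ ms) = begin
  sum (replicate k (suc b) ++ expand ms)        ≡⟨ sum-++ (replicate k (suc b)) (expand ms) ⟩
  sum (replicate k (suc b)) + sum (expand ms)   ≡⟨ cong₂ _+_ (sum-replicate k (suc b)) (sum-expand ms) ⟩
  k * suc b + weight ms                          ∎
  where open ≡-Reasoning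

multiplicities-expand : (ms : Vec ℕ b) → multiplicities b (expand ms) ≡ ms
multiplicities-expand []                = refl
multiplicities-expand {suc b} (k ∷ ms) =
  cong₂ _∷_ (runLength-replicate (suc b) k below)
            (trans (cong (multiplicities b) (dropRun-replicate (suc b) k below)) (multiplicities-expand ms))
  where below = ListAll.map s≤s (expand-≤ ms)

expand-multiplicities : ∀ b {xs} → Linked _≥_ xs → ListAll.All (0 <_) xs → ListAll.All (_≤ b) xs →
                        expand (multiplicities b xs) ≡ xs
expand-multiplicities zero    {[]}     _ _ _ = refl
expand-multiplicities zero    {_ ∷ _} _ (0<x ∷ _) (x≤0 ∷ _) = ⊥-elim (<-irrefl refl (<-≤-trans 0<x x≤0))
expand-multiplicities (suc b) {xs} sorted pos bounded = begin
  replicate (runLength c xs) c ++ expand (multiplicities b (dropRun c xs))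
    ≡⟨ cong (replicate (runLength c xs) c ++_)
            (expand-multiplicities b (dropRun-Linked c sorted) (dropRun-All c pos) (dropRun-≤ sorted bounded)) ⟩
  replicate (runLength c xs) c ++ dropRun c xs
    ≡⟨ replicate-runLength-dropRun c xs ⟩
  xs ∎
  where
  open ≡-Reasoning
  c = suc b

weight-multiplicities : ∀ b {xs} → Linked _≥_ xs → ListAll.All (0 <_) xs → ListAll.All (_≤ b) xs →
                        weight (multiplicities b xs) ≡ sum xs
weight-multiplicities b {xs} sorted pos bounded =
  trans (sym (sum-expand (multiplicities b xs))) (cong sum (expand-multiplicities b sorted pos bounded))

parts≤sum : ∀ xs → ListAll.All (_≤ sum xs) xs
parts≤sum []       = []
parts≤sum (x ∷ xs) = m≤m+n x (sum xs) ∷ ListAll.map (λ y≤ → ≤-trans y≤ (m≤n+m (sum xs) x)) (parts≤sum xs)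

parts≤ : ∀ {xs} → sum xs ≡ m → m ≤ b → ListAll.All (_≤ b) xs
parts≤ {xs = xs} refl m≤b = ListAll.map (λ x≤ → ≤-trans x≤ m≤b) (parts≤sum xs)

fromParityHalf : ℕ → ℕ → ℕ
fromParityHalf r q = r + q * 2

fromParityHalf-%2 : ∀ {r} q → r ≤ 1 → fromParityHalf r q % 2 ≡ r
fromParityHalf-%2 {r} q r≤1 = trans ([m+kn]%n≡m%n r q 2) (m<n⇒m%n≡m (s≤s r≤1))

fromParityHalf-/2 : ∀ {r} q → r ≤ 1 → fromParityHalf r q / 2 ≡ q
fromParityHalf-/2 {r} q r≤1 =
  trans (+-distrib-/-∣ʳ r (divides-refl q)) (cong₂ _+_ (m<n⇒m/n≡0 (s≤s r≤1)) (m*n/n≡m q 2))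

map-%2-≤1 : (ms : Vec ℕ b) → All (_≤ 1) (Vec.map (_% 2) ms)
map-%2-≤1 []       = []
map-%2-≤1 (k ∷ ms) = ≤-pred (m%n<n k 2) ∷ map-%2-≤1 ms

zipWith-fromParityHalf : (ms : Vec ℕ b) → zipWith fromParityHalf (Vec.map (_% 2) ms) (Vec.map (_/ 2) ms) ≡ ms
zipWith-fromParityHalf []       = refl
zipWith-fromParityHalf (k ∷ ms) = cong₂ _∷_ (sym (m≡m%n+[m/n]*n k 2)) (zipWith-fromParityHalf ms)

map-%2-zipWith : (rs qs : Vec ℕ b) → All (_≤ 1) rs → Vec.map (_% 2) (zipWith fromParityHalf rs qs) ≡ rs
map-%2-zipWith []       []       []           = refl
map-%2-zipWith (_ ∷ rs) (q ∷ qs) (r≤1 ∷ rs≤1) = cong₂ _∷_ (fromParityHalf-%2 q r≤1) (map-%2-zipWith rs qs rs≤1)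

map-/2-zipWith : (rs qs : Vec ℕ b) → All (_≤ 1) rs → Vec.map (_/ 2) (zipWith fromParityHalf rs qs) ≡ qs
map-/2-zipWith []       []       []           = refl
map-/2-zipWith (_ ∷ rs) (q ∷ qs) (r≤1 ∷ rs≤1) = cong₂ _∷_ (fromParityHalf-/2 q r≤1) (map-/2-zipWith rs qs rs≤1)

weight-zipWith : (rs qs : Vec ℕ b) → weight (zipWith fromParityHalf rs qs) ≡ weight rs + 2 * weight qs
weight-zipWith []                []       = refl
weight-zipWith {suc b} (r ∷ rs) (q ∷ qs) = begin
  (r + q * 2) * suc b + weight (zipWith fromParityHalf rs qs)
    ≡⟨ cong ((r + q * 2) * suc b +_) (weight-zipWith rs qs) ⟩
  (r + q * 2) * suc b + (weight rs + 2 * weight qs)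
    ≡⟨ regroup r q (suc b) (weight rs) (weight qs) ⟩
  (r * suc b + weight rs) + 2 * (q * suc b + weight qs) ∎
  where
  open ≡-Reasoning
  open +-*-Solver
  regroup : ∀ r q c x y → (r + q * 2) * c + (x + 2 * y) ≡ (r * c + x) + 2 * (q * c + y)
  regroup = solve 5 (λ r q c x y → (r :+ q :* con 2) :* c :+ (x :+ con 2 :* y)
                                 := (r :* c :+ x) :+ con 2 :* (q :* c :+ y)) refl

weight-parity-half : (ms : Vec ℕ b) → weight ms ≡ weight (Vec.map (_% 2) ms) + 2 * weight (Vec.map (_/ 2) ms)
weight-parity-half ms = trans (cong weight (sym (zipWith-fromParityHalf ms)))
                              (weight-zipWith (Vec.map (_% 2) ms) (Vec.map (_/ 2) ms))

weight≡0⇒≡zeros : (ms : Vec ℕ b) → weight ms ≡ 0 → ms ≡ Vec.replicate b 0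
weight≡0⇒≡zeros []           _         = refl
weight≡0⇒≡zeros (zero ∷ ms) weight≡0 = cong (0 ∷_) (weight≡0⇒≡zeros ms weight≡0)

weight-zeros : ∀ b → weight (Vec.replicate b 0) ≡ 0
weight-zeros zero    = refl
weight-zeros (suc b) = weight-zeros b

module _ (ψ : ℕ → ℕ) (ψ-injective : Injective _≡_ _≡_ ψ) where

  InImage-irrelevant : ∀ a → Irrelevant (InImage ψ a)
  InImage-irrelevant a (i , ψi≡a) (j , ψj≡a) with ψ-injective (trans ψi≡a (sym ψj≡a))
  ... | refl = cong (i ,_) (≡-irrelevant ψi≡a ψj≡a)

  Partition-≡ : {p q : Partition ψ n} → Partition.parts p ≡ Partition.parts q → p ≡ q
  Partition-≡ {p = mkPartition _ pos inA sorted total} {mkPartition _ pos′ inA′ sorted′ total′} refl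
    with ListAll.irrelevant <-irrelevant pos pos′ | ListAll.irrelevant (InImage-irrelevant _) inA inA′
       | Linked.irrelevant ≤-irrelevant sorted sorted′ | ≡-irrelevant total total′
  ... | refl | refl | refl | refl = refl

  DistinctPartition-≡ : {p q : DistinctPartition ψ n} →
                        DistinctPartition.parts p ≡ DistinctPartition.parts q → p ≡ q
  DistinctPartition-≡ {p = mkDistinctPartition _ pos inA strict total}
                      {mkDistinctPartition _ pos′ inA′ strict′ total′} refl
    with ListAll.irrelevant <-irrelevant pos pos′ | ListAll.irrelevant (InImage-irrelevant _) inA inA′
       | Linked.irrelevant <-irrelevant strict strict′ | ≡-irrelevant total total′
  ... | refl | refl | refl | refl = refl

  -- A sum rather than `0 < k → InImage ψ c`, so that it is a proposition (ψ being injective)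
  -- without appealing to function extensionality.
  Supported : ℕ → ℕ → Set
  Supported c k = k ≡ 0 ⊎ (0 < k × InImage ψ c)

  Supported-irrelevant : ∀ c k → Irrelevant (Supported c k)
  Supported-irrelevant c k (inj₁ p)        (inj₁ q)        = cong inj₁ (≡-irrelevant p q)
  Supported-irrelevant c k (inj₁ refl)     (inj₂ (() , _))
  Supported-irrelevant c k (inj₂ (() , _)) (inj₁ refl)
  Supported-irrelevant c k (inj₂ p)        (inj₂ q)        =
    cong inj₂ (×-irrelevant <-irrelevant (InImage-irrelevant c) p q)

  InImage⇒Supported : ∀ {c} → InImage ψ c → ∀ k → Supported c k
  InImage⇒Supported _   zero    = inj₁ refl
  InImage⇒Supported c∈A (suc k) = inj₂ (z<s , c∈A)

  Admissible : Vec ℕ b → Set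
  Admissible []                = ⊤
  Admissible {suc b} (k ∷ ms) = Supported (suc b) k × Admissible ms

  Admissible-irrelevant : (ms : Vec ℕ b) → Irrelevant (Admissible ms)
  Admissible-irrelevant []                = λ _ _ → refl
  Admissible-irrelevant {suc b} (k ∷ ms) =
    ×-irrelevant (Supported-irrelevant (suc b) k) (Admissible-irrelevant ms)

  Multiplicities : ℕ → Set
  Multiplicities b = Σ (Vec ℕ b) Admissible

  Multiplicities₀₁ : ℕ → Set
  Multiplicities₀₁ b = Σ (Vec ℕ b) (λ ms → All (_≤ 1) ms × Admissible ms)

  Multiplicities₀₁-irrelevant : (ms : Vec ℕ b) → Irrelevant (All (_≤ 1) ms × Admissible ms)
  Multiplicities₀₁-irrelevant ms = ×-irrelevant (VecAll.irrelevant ≤-irrelevant) (Admissible-irrelevant ms)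

  runLength-Supported : ∀ c {xs} → ListAll.All (InImage ψ) xs → Supported c (runLength c xs)
  runLength-Supported c {[]}     _         = inj₁ refl
  runLength-Supported c {x ∷ _} (x∈A ∷ _) with x ≟ c
  ... | yes refl = inj₂ (z<s , x∈A)
  ... | no  _    = inj₁ refl

  multiplicities-Admissible : ∀ b {xs} → ListAll.All (InImage ψ) xs → Admissible (multiplicities b xs)
  multiplicities-Admissible zero    _    = tt
  multiplicities-Admissible (suc b) xs∈A =
    runLength-Supported (suc b) xs∈A , multiplicities-Admissible b (dropRun-All (suc b) xs∈A)

  expand-InImage : (ms : Vec ℕ b) → Admissible ms → ListAll.All (InImage ψ) (expand ms)
  expand-InImage []       _                       = []
  expand-InImage (k ∷ ms) (inj₁ refl , adm)       = expand-InImage ms adm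
  expand-InImage (k ∷ ms) (inj₂ (_ , c∈A) , adm) = ++⁺ (replicate⁺ k c∈A) (expand-InImage ms adm)

  partition↔multiplicities : m ≤ b → Partition ψ m ↔ Σ (Multiplicities b) (λ μ → weight (proj₁ μ) ≡ m)
  partition↔multiplicities {m} {b} m≤b = mk↔ₛ′ to from to∘from from∘to
    where
    to : Partition ψ m → Σ (Multiplicities b) (λ μ → weight (proj₁ μ) ≡ m)
    to (mkPartition xs pos xs∈A sorted total) =
      (multiplicities b xs , multiplicities-Admissible b xs∈A) ,
      trans (weight-multiplicities b sorted pos (parts≤ total m≤b)) total
    from : Σ (Multiplicities b) (λ μ → weight (proj₁ μ) ≡ m) → Partition ψ m
    from ((ms , adm) , weight≡m) =
      mkPartition (expand ms) (expand-positive ms) (expand-InImage ms adm) (expand-sorted ms)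
                  (trans (sum-expand ms) weight≡m)
    to∘from : ∀ μ → to (from μ) ≡ μ
    to∘from ((ms , _) , _) =
      Σ-≡-irrelevant (λ _ → ≡-irrelevant) (Σ-≡-irrelevant Admissible-irrelevant (multiplicities-expand ms))
    from∘to : ∀ p → from (to p) ≡ p
    from∘to (mkPartition _ pos _ sorted total) =
      Partition-≡ (expand-multiplicities b sorted pos (parts≤ total m≤b))

  distinctPartition↔multiplicities₀₁ : m ≤ b →
    DistinctPartition ψ m ↔ Σ (Multiplicities₀₁ b) (λ β → weight (proj₁ β) ≡ m)
  distinctPartition↔multiplicities₀₁ {m} {b} m≤b = mk↔ₛ′ to from to∘from from∘to
    where
    to : DistinctPartition ψ m → Σ (Multiplicities₀₁ b) (λ β → weight (proj₁ β) ≡ m)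
    to (mkDistinctPartition xs pos xs∈A strict total) =
      (multiplicities b xs , runLengths-≤1 b strict , multiplicities-Admissible b xs∈A) ,
      trans (weight-multiplicities b (Linked.map <⇒≤ strict) pos (parts≤ total m≤b)) total
      where
      runLengths-≤1 : ∀ b {xs} → Linked _>_ xs → All (_≤ 1) (multiplicities b xs)
      runLengths-≤1 zero    _      = []
      runLengths-≤1 (suc b) strict =
        runLength-≤1 (suc b) strict ∷ runLengths-≤1 b (dropRun-Linked (suc b) strict)
    from : Σ (Multiplicities₀₁ b) (λ β → weight (proj₁ β) ≡ m) → DistinctPartition ψ m
    from ((ms , ms≤1 , adm) , weight≡m) =
      mkDistinctPartition (expand ms) (expand-positive ms) (expand-InImage ms adm) (expand-strict ms ms≤1)
                          (trans (sum-expand ms) weight≡m)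
    to∘from : ∀ β → to (from β) ≡ β
    to∘from ((ms , _) , _) =
      Σ-≡-irrelevant (λ _ → ≡-irrelevant) (Σ-≡-irrelevant Multiplicities₀₁-irrelevant (multiplicities-expand ms))
    from∘to : ∀ p → from (to p) ≡ p
    from∘to (mkDistinctPartition _ pos _ strict total) =
      DistinctPartition-≡ (expand-multiplicities b (Linked.map <⇒≤ strict) pos (parts≤ total m≤b))

  Supported-map : ∀ {c k} (f : ℕ → ℕ) → f 0 ≡ 0 → Supported c k → Supported c (f k)
  Supported-map f f0≡0 (inj₁ refl)       = inj₁ f0≡0
  Supported-map f _    (inj₂ (_ , c∈A)) = InImage⇒Supported c∈A _

  Admissible-map : (f : ℕ → ℕ) → f 0 ≡ 0 → (ms : Vec ℕ b) → Admissible ms → Admissible (Vec.map f ms)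
  Admissible-map f f0≡0 []       _           = tt
  Admissible-map f f0≡0 (_ ∷ ms) (s , adm) = Supported-map f f0≡0 s , Admissible-map f f0≡0 ms adm

  Admissible-zipWith : (rs qs : Vec ℕ b) → Admissible rs → Admissible qs →
                       Admissible (zipWith fromParityHalf rs qs)
  Admissible-zipWith []       []       _ _ = tt
  Admissible-zipWith (r ∷ rs) (q ∷ qs) (sr , adm) (sq , adm′) =
    supported sr sq , Admissible-zipWith rs qs adm adm′
    where
    supported : ∀ {c} → Supported c r → Supported c q → Supported c (fromParityHalf r q)
    supported (inj₁ refl)       (inj₁ refl)       = inj₁ refl
    supported (inj₂ (_ , c∈A)) _                  = InImage⇒Supported c∈A _
    supported (inj₁ refl)       (inj₂ (_ , c∈A)) = InImage⇒Supported c∈A _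

  halve : Multiplicities b ↔ (Multiplicities₀₁ b × Multiplicities b)
  halve = mk↔ₛ′ split join split∘join join∘split
    where
    split : Multiplicities b → Multiplicities₀₁ b × Multiplicities b
    split (ms , adm) = (Vec.map (_% 2) ms , map-%2-≤1 ms , Admissible-map (_% 2) refl ms adm)
                     , (Vec.map (_/ 2) ms , Admissible-map (_/ 2) refl ms adm)
    join : Multiplicities₀₁ b × Multiplicities b → Multiplicities b
    join ((rs , _ , adm) , (qs , adm′)) = zipWith fromParityHalf rs qs , Admissible-zipWith rs qs adm adm′
    split∘join : ∀ y → split (join y) ≡ y
    split∘join ((rs , rs≤1 , _) , (qs , _)) =
      cong₂ _,_ (Σ-≡-irrelevant Multiplicities₀₁-irrelevant (map-%2-zipWith rs qs rs≤1))
                (Σ-≡-irrelevant Admissible-irrelevant (map-/2-zipWith rs qs rs≤1))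
    join∘split : ∀ μ → join (split μ) ≡ μ
    join∘split (ms , _) = Σ-≡-irrelevant Admissible-irrelevant (zipWith-fromParityHalf ms)

  weight₀₁ : Multiplicities₀₁ b → ℕ
  weight₀₁ = weight ∘ proj₁

  digitsWeight : Vec (Multiplicities₀₁ b) k → ℕ
  digitsWeight ds = weighted (Vec.map weight₀₁ ds)

  -- The i-th vector holds the i-th binary digits of all multiplicities.
  binaryExpansion : ∀ K → Multiplicities b ↔ (Vec (Multiplicities₀₁ b) K × Multiplicities b)
  binaryExpansion zero    = mk↔ₛ′ ([] ,_) proj₂ (λ { ([] , _) → refl }) (λ _ → refl)
  binaryExpansion (suc K) = ↔-trans halve (↔-trans (↔-refl ×-↔ binaryExpansion K) Vec-∷↔)

  expansionWeight : ∀ K → Vec (Multiplicities₀₁ b) K × Multiplicities b → ℕ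
  expansionWeight K (ds , ρ) = digitsWeight ds + 2 ^ K * weight (proj₁ ρ)

  expansionWeight-binaryExpansion : ∀ K (μ : Multiplicities b) →
                                    expansionWeight K (Inverse.to (binaryExpansion K) μ) ≡ weight (proj₁ μ)
  expansionWeight-binaryExpansion zero    (ms , _)   = +-identityʳ (weight ms)
  expansionWeight-binaryExpansion (suc K) μ@(ms , _) = begin
    weighted (weight rs ∷ Vec.map weight₀₁ ds) + 2 ^ suc K * weight (proj₁ ρ)
      ≡⟨ cong₂ _+_ (weighted-∷ (weight rs) (Vec.map weight₀₁ ds)) (*-assoc 2 (2 ^ K) (weight (proj₁ ρ))) ⟩
    (weight rs + 2 * digitsWeight ds) + 2 * (2 ^ K * weight (proj₁ ρ))
      ≡⟨ +-assoc (weight rs) (2 * digitsWeight ds) _ ⟩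
    weight rs + (2 * digitsWeight ds + 2 * (2 ^ K * weight (proj₁ ρ)))
      ≡⟨ cong (weight rs +_) (*-distribˡ-+ 2 (digitsWeight ds) (2 ^ K * weight (proj₁ ρ))) ⟨
    weight rs + 2 * expansionWeight K (ds , ρ)
      ≡⟨ cong (λ w → weight rs + 2 * w) (expansionWeight-binaryExpansion K μ′) ⟩
    weight rs + 2 * weight (Vec.map (_/ 2) ms)
      ≡⟨ weight-parity-half ms ⟨
    weight ms ∎
    where
    open ≡-Reasoning
    rs = Vec.map (_% 2) ms
    μ′ = proj₂ (Inverse.to halve μ)
    ds = proj₁ (Inverse.to (binaryExpansion K) μ′)
    ρ  = proj₂ (Inverse.to (binaryExpansion K) μ′)

  zeros : Multiplicities b
  zeros {b} = Vec.replicate b 0 , zeros-Admissible b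
    where
    zeros-Admissible : ∀ b → Admissible (Vec.replicate b 0)
    zeros-Admissible zero    = tt
    zeros-Admissible (suc b) = inj₁ refl , zeros-Admissible b

  binaryExpansion-fibre : ∀ K → n < 2 ^ K →
    Σ (Multiplicities b) (λ μ → weight (proj₁ μ) ≡ n) ↔
    Σ (Vec (Multiplicities₀₁ b) K) (λ ds → digitsWeight ds ≡ n)
  binaryExpansion-fibre {n = n} {b = b} K n<2^K =
    ↔-trans (Σ-↔-weighted {P = _≡ n} (binaryExpansion K) (expansionWeight-binaryExpansion K))
            (Σ-×-discard-high-part digitsWeight (weight ∘ proj₁) zeros (weight-zeros b) zeros-unique n<2^K)
    where
    zeros-unique : (μ : Multiplicities b) → weight (proj₁ μ) ≡ 0 → μ ≡ zeros
    zeros-unique (ms , _) weight≡0 = Σ-≡-irrelevant Admissible-irrelevant (weight≡0⇒≡zeros ms weight≡0)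

  partition↔weightedDistinctPartitions : ∀ n → Partition ψ n ↔
    Σ (Vec ℕ (suc n)) (λ v → All (_< suc n) v × (All (DistinctPartition ψ) v × weighted v ≡ n))
  partition↔weightedDistinctPartitions n = begin
    Partition ψ n
      ↔⟨ partition↔multiplicities ≤-refl ⟩
    Σ (Multiplicities n) (λ μ → weight (proj₁ μ) ≡ n)
      ↔⟨ binaryExpansion-fibre (suc n) (<-trans (n<1+n n) (n<2^n (suc n))) ⟩
    Σ (Vec (Multiplicities₀₁ n) (suc n)) (λ ds → weighted (Vec.map weight₀₁ ds) ≡ n)
      ↔⟨ Σ-Vec↔weights×fibres weight₀₁ (λ v → weighted v ≡ n) ⟩
    Σ (Vec ℕ (suc n)) (λ v → All (Fibre weight₀₁) v × weighted v ≡ n)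
      ↔⟨ Σ-↔ ↔-refl (λ {v} → ↔-×-implied (VecAll.irrelevant <-irrelevant)
                                         (λ (_ , e) → weightedFrom≤⇒All< 0 v (≤-reflexive e))) ⟩
    Σ (Vec ℕ (suc n)) (λ v → All (_< suc n) v × (All (Fibre weight₀₁) v × weighted v ≡ n))
      ↔⟨ Σ-↔ ↔-refl (Σ-↔ ↔-refl (λ {v<} → All-↔ (VecAll.map fibre↔distinct v<) ×-↔ ↔-refl)) ⟩
    Σ (Vec ℕ (suc n)) (λ v → All (_< suc n) v × (All (DistinctPartition ψ) v × weighted v ≡ n)) ∎
    where
    open Related.EquationalReasoning
    fibre↔distinct : ∀ {x} → x < suc n → Fibre weight₀₁ x ↔ DistinctPartition ψ x
    fibre↔distinct x<1+n = ↔-sym (distinctPartition↔multiplicities₀₁ (≤-pred x<1+n))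

mainTheorem1 : (ψ : ℕ → ℕ) → Injective _≡_ _≡_ ψ →
    (p p₁ : ℕ → ℕ) →
    (∀ m → Partition ψ m ↔ Fin (p m)) →
    (∀ m → DistinctPartition ψ m ↔ Fin (p₁ m)) →
    ∀ n → p n ≡ rhs p₁ n
mainTheorem1 ψ ψ-injective p p₁ p↔ p₁↔ n =
  ↔⇒≡ (↔-trans (↔-sym (p↔ n))
      (↔-trans (partition↔weightedDistinctPartitions ψ ψ-injective n) (rhs-count p₁ p₁↔ n)))
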